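{- (Necklace Lemma) Let $D$ be any digraph and $\mathcal{U}$ a finite set of vertex sets of $D$. Then exactly one of the following holds: (i) $D$ contains a necklace attached to $\mathcal{U}$ (as a subdigraph); (ii) $D$ has a $\mathcal{U}$-rank.
   Context: Digraphs have no loops and no parallel edges, but may contain both $uv$ and $vu$. $\mathcal{X}(D)$ is the set of finite subsets of $V(D)$. For vertex sets $A,B$, an $A$–$B$ path is a directed path meeting $A$ exactly in its first vertex and $B$ exactly in its last vertex. A necklace is a digraph $N$ that is the union of: pairwise disjoint finite vertex sets $Y_0,Y_1,Y_2,\dots$ (the beads) each spanning a strongly connected digraph $H_i$ with $V(H_i)=Y_i$, together with, for each $i$, a $Y_i$–$Y_{i+1}$ path $P_i$ and a $Y_{i+1}$–$Y_i$ path $Q_i$, where all these paths are internally disjoint from each other and from all beads (i.e. $N$ is an inflated symmetric ray with finite branch sets). A necklace $N\subseteq D$ is attached to $\mathcal{U}$ if infinitely many beads of $N$ each meet every set in $\mathcal{U}$. $\mathcal{U}$-rank (for a finite set $\mathcal{U}$ of vertex sets), defined by transfinite recursion: a digraph $D$ has $\mathcal{U}$-rank $0$ if $U\cap V(D)$ is finite for some $U\in\mathcal{U}$; it has $\mathcal{U}$-rank $\alpha$ if it has no $\mathcal{U}$-rank $<\alpha$ and there is $X\in\mathcal{X}(D)$ such that every strong component of $D-X$ has a $\mathcal{U}$-rank $<\alpha$. $D$ has a $\mathcal{U}$-rank if it has $\mathcal{U}$-rank $\alpha$ for some ordinal $\alpha$. -}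

module Defs where

open import Level using (0ℓ) renaming (suc to lsuc)
open import Data.Nat using (ℕ; suc; _≤_)
open import Data.Bool using (Bool)
open import Data.Product using (Σ; ∃; ∃-syntax; _×_; _,_)
open import Data.Sum using (_⊎_)
open import Data.Empty using (⊥)
open import Data.List using (List; []; _∷_; _++_; [_])
open import Data.List.Membership.Propositional using (_∈_; _∉_)
open import Data.List.Relation.Unary.All using (All)
open import Data.List.Relation.Unary.Any using (Any)
open import Data.List.Relation.Unary.Linked using (Linked)
open import Data.List.Relation.Unary.Unique.Propositional using (Unique)
open import Relation.Nullary using (¬_)
open import Relation.Unary using (Pred; _∩_; ∁; U)
open import Relation.Binary.PropositionalEquality using (_≡_)

-- A digraph: vertex type and edge relation; no loops, no parallel edges
-- (an edge uv is either present or not: E u v is a proposition).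
-- Both uv and vu may be present.
record Digraph : Set₁ where
  field
    V      : Set
    E      : V → V → Set
    loopless : ∀ v → ¬ E v v
    simple   : ∀ {u v} (p q : E u v) → p ≡ q

module _ (D : Digraph) where
  open Digraph D

  VSet : Set₁
  VSet = Pred V 0ℓ

  Finite : VSet → Set
  Finite A = ∃[ xs ] (∀ v → A v → v ∈ xs)

  data Reach (S : VSet) : V → V → Set where
    here  : ∀ {u} → S u → Reach S u u
    step  : ∀ {u w x} → S u → E u w → Reach S w x → Reach S u x

  Minus : VSet → List V → VSet
  Minus S X = λ v → S v × v ∉ X

  Comp : VSet → V → VSet
  Comp S v = λ w → Reach S v w × Reach S w v

  -- "D[S] has a 𝒰-rank": the least predicate closed under the two clauses
  -- of the transfinite definition (rank 0; and: some finite X such that every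
  -- strong component of D[S] - X has a (smaller) rank).
  data HasRank (𝒰 : List VSet) : VSet → Set₁ where
    rank0    : ∀ {S} → Any (λ W → Finite (W ∩ S)) 𝒰 → HasRank 𝒰 S
    rankStep : ∀ {S} (X : List V) →
               (∀ v → Minus S X v → HasRank 𝒰 (Comp (Minus S X) v)) →
               HasRank 𝒰 S

  record Path (A B : VSet) : Set where
    field
      start  : V
      mid    : List V
      end    : V
      linked : Linked E (start ∷ mid ++ [ end ])
      unique : Unique (start ∷ mid ++ [ end ])
      startA : A start
      endB   : B end
      startNotB : ¬ B start
      endNotA   : ¬ A end
      midNotA   : All (∁ A) mid
      midNotB   : All (∁ B) mid

  open Path public

  InList : List V → VSet
  InList Y = λ v → v ∈ Y

  record NecklaceAttached (𝒰 : List VSet) : Set₁ where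
    field
      bead     : ℕ → List V
      beadsDisjoint : ∀ i j v → v ∈ bead i → v ∈ bead j → i ≡ j
      beadStrong : ∀ i u w → u ∈ bead i → w ∈ bead i → Reach (InList (bead i)) u w
      P : ∀ i → Path (InList (bead i)) (InList (bead (suc i)))
      Q : ∀ i → Path (InList (bead (suc i))) (InList (bead i))
      PP-disj : ∀ i j v → v ∈ mid (P i) → v ∈ mid (P j) → i ≡ j
      QQ-disj : ∀ i j v → v ∈ mid (Q i) → v ∈ mid (Q j) → i ≡ j
      PQ-disj : ∀ i j v → v ∈ mid (P i) → v ∈ mid (Q j) → ⊥
      P-beads : ∀ i j v → v ∈ mid (P i) → v ∉ bead j
      Q-beads : ∀ i j v → v ∈ mid (Q i) → v ∉ bead j
      -- attached: infinitely many beads meet every set in 𝒰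
      attached : ∀ n → ∃[ i ] (n ≤ i × All (λ W → ∃[ v ] (v ∈ bead i × W v)) 𝒰)

-- If D has no 𝒰-rank, some strong component R₀ of D has none either, and iterating, some
-- strong component Rₙ₊₁ of Rₙ minus all beads chosen so far has none. A rankless region
-- meets every set of 𝒰, so strong connectivity gives a finite strongly connected bead
-- Yₙ ⊆ Rₙ meeting all of 𝒰. Paths inside Rₙ from Yₙ into Rₙ₊₁ and back give Pₙ and Qₙ,
-- once Yₙ₊₁ is chosen through their ends. As the regions shrink and avoid all earlier
-- beads, beads and paths are disjoint.
-- Conversely, every tail of a necklace is strongly connected and eventually avoids any
-- finite set, so along a rank decomposition it always stays inside one strong component,
-- until at rank 0 its beads meet the finite set W ∩ S (W ∈ 𝒰) infinitely often.

module Submission where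

open import Defs
open import Function using (_∘_)
open import Data.Nat using (ℕ; zero; suc; _≤_; _<_; _≤?_; _≤′_; ≤′-refl; ≤′-step; _⊔_)
open import Data.Nat.Properties
  using (≤-refl; <-cmp; <⇒≢; ≰⇒>; m≤n⇒m≤1+n; ≤⇒≤′; ≤′⇒≤; m⊔n≤o⇒m≤o; m⊔n≤o⇒n≤o)
open import Data.Product as Product using (Σ-syntax; ∃-syntax; _×_; _,_; proj₁; proj₂; swap)
open import Data.Sum using (_⊎_; inj₁; inj₂; [_,_]′)
open import Data.Empty using (⊥; ⊥-elim)
open import Data.Unit using (tt)
open import Data.List using (List; []; _∷_; _++_; [_])
open import Data.List.Properties using (++-assoc)
open import Data.List.Membership.Propositional using (_∈_; _∉_)
open import Data.List.Membership.Propositional.Properties using (∈-++⁺ˡ; ∈-++⁺ʳ; ∈-++⁻; ∈-∃++)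
open import Data.List.Relation.Unary.Any using (Any; here; there)
open import Data.List.Relation.Unary.Any.Properties using (lookup-result)
open import Data.List.Relation.Unary.All as All using (All; []; _∷_)
open import Data.List.Relation.Unary.All.Properties as Allₚ using ()
open import Data.List.Relation.Unary.Linked as Linked using (Linked; [-]; _∷_)
open import Data.List.Relation.Unary.AllPairs as AllPairs using ([]; _∷_)
open import Data.List.Relation.Unary.Unique.Propositional using (Unique)
open import Relation.Binary.Definitions using (tri<; tri≈; tri>)
open import Relation.Binary.PropositionalEquality using (_≡_; refl; trans; subst; cong)
open import Relation.Nullary using (¬_; yes; no)
open import Relation.Unary using (U; _∩_; ∁; _⊆_)
open import Axiom.ExcludedMiddle using (ExcludedMiddle)

dropPrefix : ∀ {A : Set} (Q : List A → Set) → (∀ {x xs} → Q (x ∷ xs) → Q xs) →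
             ∀ xs {ys} → Q (xs ++ ys) → Q ys
dropPrefix _ _    []       q = q
dropPrefix Q tail (_ ∷ xs) q = dropPrefix Q tail xs (tail q)

index-unique : {Q : ℕ → Set} → (∀ {i j} → i < j → Q i → Q j → ⊥) → ∀ {i j} → Q i → Q j → i ≡ j
index-unique apart {i} {j} qi qj with <-cmp i j
... | tri< i<j _ _ = ⊥-elim (apart i<j qi qj)
... | tri≈ _ i≡j _ = i≡j
... | tri> _ _ j<i = ⊥-elim (apart j<i qj qi)

module Walks (D : Digraph) where
  open Digraph D

  private variable
    S T M : VSet D
    a c u w x y : V
    xs ys : List V

  reach-trans : Reach D S u w → Reach D S w x → Reach D S u x
  reach-trans (here _)     r = r
  reach-trans (step s e r) r′ = step s e (reach-trans r r′)

  reach-mono : S ⊆ T → Reach D S u w → Reach D T u w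
  reach-mono S⊆T (here s)     = here (S⊆T s)
  reach-mono S⊆T (step s e r) = step (S⊆T s) e (reach-mono S⊆T r)

  reach-source : Reach D S u w → S u
  reach-source (here s)     = s
  reach-source (step s _ _) = s

  reach-target : Reach D S u w → S w
  reach-target (here s)     = s
  reach-target (step _ _ r) = reach-target r

  comp-refl : S u → Comp D S u u
  comp-refl s = here s , here s

  comp-trans : Comp D S u w → Comp D S w x → Comp D S u x
  comp-trans (uw , wu) (wx , xw) = reach-trans uw wx , reach-trans xw wu

  comp-sym : Comp D S u w → Comp D S w u
  comp-sym = swap

  StronglyConnected : VSet D → Set
  StronglyConnected S = ∀ u w → S u → S w → Reach D S u w

  rooted⇒stronglyConnected : S ⊆ Comp D S a → StronglyConnected S
  rooted⇒stronglyConnected rooted u w su sw = proj₁ (comp-trans (comp-sym (rooted su)) (rooted sw))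

  walk-in-comp : Reach D M u w → Reach D M c u → Reach D M w c → Reach D (Comp D M c) u w
  walk-in-comp (here mu)     cu wc = here (cu , wc)
  walk-in-comp (step mu e r) cu wc =
    step (cu , reach-trans (step mu e r) wc) e
         (walk-in-comp r (reach-trans cu (step mu e (here (reach-source r)))) wc)

  comp-stronglyConnected : StronglyConnected (Comp D M c)
  comp-stronglyConnected u w (cu , uc) (cw , wc) = walk-in-comp (reach-trans uc cw) cu wc

  Meets : VSet D → VSet D → Set
  Meets S W = ∃[ v ] (S v × W v)

  meets-mono : S ⊆ T → ∀ {W} → Meets S W → Meets T W
  meets-mono S⊆T (v , s , w) = v , S⊆T s , w

  vertices : Reach D S u w → List V
  vertices (here {u} _)     = [ u ]
  vertices (step {u} _ _ r) = u ∷ vertices r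

  vertices-⊆ : (r : Reach D S u w) → InList D (vertices r) ⊆ S
  vertices-⊆ (here s)     (here refl) = s
  vertices-⊆ (step s _ _) (here refl) = s
  vertices-⊆ (step _ _ r) (there y∈) = vertices-⊆ r y∈

  vertices-source : (r : Reach D S u w) → u ∈ vertices r
  vertices-source (here _)     = here refl
  vertices-source (step _ _ _) = here refl

  vertices-target : (r : Reach D S u w) → w ∈ vertices r
  vertices-target (here _)     = here refl
  vertices-target (step _ _ r) = there (vertices-target r)

  vertices-reach : (r : Reach D S u w) → y ∈ vertices r →
                   Reach D (InList D (vertices r)) u y × Reach D (InList D (vertices r)) y w
  vertices-reach (here _)     (here refl) = here (here refl) , here (here refl)
  vertices-reach (step _ e r) (here refl) =
    here (here refl) , step (here refl) e (reach-mono there (proj₂ (vertices-reach r (vertices-source r))))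
  vertices-reach (step _ e r) (there y∈) =
    step (here refl) e (reach-mono there (proj₁ (vertices-reach r y∈))) ,
    reach-mono there (proj₂ (vertices-reach r y∈))

  closedWalk-rooted : (r : Reach D S a w) (r′ : Reach D S w a) →
                      InList D (vertices r ++ vertices r′) ⊆ Comp D (InList D (vertices r ++ vertices r′)) a
  closedWalk-rooted r r′ y∈ with ∈-++⁻ (vertices r) y∈
  ... | inj₁ y∈r  = reach-mono ∈-++⁺ˡ (proj₁ (vertices-reach r y∈r)) ,
                    reach-trans (reach-mono ∈-++⁺ˡ (proj₂ (vertices-reach r y∈r)))
                                (reach-mono (∈-++⁺ʳ _) (proj₂ (vertices-reach r′ (vertices-source r′))))
  ... | inj₂ y∈r′ = reach-trans (reach-mono ∈-++⁺ˡ (proj₁ (vertices-reach r (vertices-target r))))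
                                (reach-mono (∈-++⁺ʳ _) (proj₁ (vertices-reach r′ y∈r′))) ,
                    reach-mono (∈-++⁺ʳ _) (proj₂ (vertices-reach r′ y∈r′))

  rooted-++ : InList D xs ⊆ Comp D (InList D xs) a → InList D ys ⊆ Comp D (InList D ys) a →
              InList D (xs ++ ys) ⊆ Comp D (InList D (xs ++ ys)) a
  rooted-++ {xs} rootedˡ rootedʳ y∈ with ∈-++⁻ xs y∈
  ... | inj₁ y∈xs = Product.map (reach-mono ∈-++⁺ˡ) (reach-mono ∈-++⁺ˡ) (rootedˡ y∈xs)
  ... | inj₂ y∈ys = Product.map (reach-mono (∈-++⁺ʳ xs)) (reach-mono (∈-++⁺ʳ xs)) (rootedʳ y∈ys)

  record Hull (S : VSet D) (a : V) (Ws : List (VSet D)) : Set₁ where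
    field
      hull   : List V
      hull⊆  : InList D hull ⊆ S
      root∈  : a ∈ hull
      rooted : InList D hull ⊆ Comp D (InList D hull) a
      meets  : All (Meets (InList D hull)) Ws

  finiteHull : StronglyConnected S → S a → ∀ {Ws} → All (Meets S) Ws → Hull S a Ws
  finiteHull {a = a} _ sa [] = record
    { hull = [ a ] ; hull⊆ = λ { (here refl) → sa } ; root∈ = here refl
    ; rooted = λ { (here refl) → comp-refl (here refl) } ; meets = [] }
  finiteHull {S} {a} strong sa ((t , st , wt) ∷ ms) = record
    { hull   = loop ++ hull
    ; hull⊆  = λ y∈ → [ loop⊆ , hull⊆ ]′ (∈-++⁻ loop y∈)
    ; root∈  = ∈-++⁺ʳ loop root∈
    ; rooted = rooted-++ (closedWalk-rooted to from) rooted
    ; meets  = (t , ∈-++⁺ˡ (∈-++⁺ˡ (vertices-target to)) , wt) ∷ All.map (meets-mono (∈-++⁺ʳ loop)) meets }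
    where
      open Hull (finiteHull strong sa ms)
      to : Reach D S a t
      to = strong a t sa st
      from : Reach D S t a
      from = strong t a st sa
      loop : List V
      loop = vertices to ++ vertices from
      loop⊆ : InList D loop ⊆ S
      loop⊆ y∈ = [ vertices-⊆ to , vertices-⊆ from ]′ (∈-++⁻ (vertices to) y∈)

  reach-from-head : Linked E (x ∷ xs ++ ys) → All T (x ∷ xs) → y ∈ x ∷ xs → Reach D T x y
  reach-from-head               _       (tx ∷ _) (here refl) = here tx
  reach-from-head {xs = _ ∷ xs} (e ∷ l) (tx ∷ t) (there y∈)  = step tx e (reach-from-head {xs = xs} l t y∈)

  reach-to-last : Linked E (xs ++ [ x ]) → All T (xs ++ [ x ]) → y ∈ xs → Reach D T y x
  reach-to-last {xs = _ ∷ []}     (e ∷ _) (ty ∷ tx ∷ []) (here refl) = step ty e (here tx)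
  reach-to-last {xs = _ ∷ _ ∷ xs} (e ∷ l) (ty ∷ t)       (here refl) =
    step ty e (reach-to-last {xs = _ ∷ xs} l t (here refl))
  reach-to-last {xs = _ ∷ _ ∷ xs} (_ ∷ l) (_ ∷ t)        (there y∈)  = reach-to-last {xs = _ ∷ xs} l t y∈

  module _ {A B : VSet D} (p : Path D A B) where

    pathVertices : List V
    pathVertices = start p ∷ mid p ++ [ end p ]

    pathVertices-⊆ : S (start p) → InList D (mid p) ⊆ S → S (end p) → All S pathVertices
    pathVertices-⊆ {S} s₀ mid⊆ s₁ = s₀ ∷ Allₚ.++⁺ (All.tabulate mid⊆) (s₁ ∷ [])

    path-start⇝end : All T pathVertices → Reach D T (start p) (end p)
    path-start⇝end t = reach-to-last {xs = start p ∷ mid p} (linked p) t (here refl)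

    path-start⇝mid : All T (start p ∷ mid p) → y ∈ mid p → Reach D T (start p) y
    path-start⇝mid t y∈ = reach-from-head (linked p) t (there y∈)

    path-mid⇝end : All T (mid p ++ [ end p ]) → y ∈ mid p → Reach D T y (end p)
    path-mid⇝end = reach-to-last (Linked.tail (linked p))

  mid⊆ : ∀ {A B} (p : Path D A B) → All S (pathVertices p) → InList D (mid p) ⊆ S
  mid⊆ p within v∈ = All.lookup within (there (∈-++⁺ˡ v∈))

  shrinkSource : ∀ {A A′ B} (p : Path D A B) → A′ ⊆ A → A′ (start p) → Path D A′ B
  shrinkSource p A′⊆A s = record
    { start = start p ; mid = mid p ; end = end p ; linked = linked p ; unique = unique p
    ; startA = s ; endB = endB p ; startNotB = startNotB p ; endNotA = endNotA p ∘ A′⊆A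
    ; midNotA = All.map (_∘ A′⊆A) (midNotA p) ; midNotB = midNotB p }

  shrinkTarget : ∀ {A B B′} (p : Path D A B) → B′ ⊆ B → B′ (end p) → Path D A B′
  shrinkTarget p B′⊆B e = record
    { start = start p ; mid = mid p ; end = end p ; linked = linked p ; unique = unique p
    ; startA = startA p ; endB = e ; startNotB = startNotB p ∘ B′⊆B ; endNotA = endNotA p
    ; midNotA = midNotA p ; midNotB = All.map (_∘ B′⊆B) (midNotB p) }

module PathExtraction (lem : ∀ {ℓ} → ExcludedMiddle ℓ) (D : Digraph) where
  open Digraph D
  open Walks D

  PathWithin : VSet D → VSet D → VSet D → Set
  PathWithin A B S = Σ[ p ∈ Path D A B ] All S (pathVertices p)

  module _ {A B S : VSet D} (disjoint : ∀ {v} → A v → ¬ B v) where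

    -- w followed by a path into B whose vertices after w avoid A; w itself may lie outside A.
    record Route (w : V) : Set where
      field
        inner     : List V
        last      : V
        linkedᵣ   : Linked E (w ∷ inner ++ [ last ])
        uniqueᵣ   : Unique (w ∷ inner ++ [ last ])
        withinᵣ   : All S (w ∷ inner ++ [ last ])
        lastB     : B last
        lastNotA  : ¬ A last
        firstNotB : ¬ B w
        innerNotA : All (∁ A) inner
        innerNotB : All (∁ B) inner

    open Route

    route⇒path : ∀ {w} → A w → Route w → PathWithin A B S
    route⇒path {w} aw ρ = record
      { start = w ; mid = inner ρ ; end = last ρ ; linked = linkedᵣ ρ ; unique = uniqueᵣ ρ
      ; startA = aw ; endB = lastB ρ ; startNotB = firstNotB ρ ; endNotA = lastNotA ρ
      ; midNotA = innerNotA ρ ; midNotB = innerNotB ρ } , withinᵣ ρ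

    edgeRoute : ∀ {w w′} → S w → S w′ → E w w′ → ¬ B w → B w′ → Route w
    edgeRoute {w} sw sw′ e ¬bw bw′ = record
      { inner = [] ; last = _ ; linkedᵣ = e ∷ [-]
      ; uniqueᵣ = ((λ { refl → loopless w e }) ∷ []) ∷ [] ∷ []
      ; withinᵣ = sw ∷ sw′ ∷ [] ; lastB = bw′ ; lastNotA = λ a → disjoint a bw′
      ; firstNotB = ¬bw ; innerNotA = [] ; innerNotB = [] }

    consRoute : ∀ {w w′} → S w → E w w′ → ¬ A w′ → ¬ B w′ → ¬ B w → (ρ : Route w′) → w ∉ inner ρ → Route w
    consRoute {w} {w′} sw e ¬aw′ ¬bw′ ¬bw ρ w∉ = record
      { inner = w′ ∷ inner ρ ; last = last ρ ; linkedᵣ = e ∷ linkedᵣ ρ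
      ; uniqueᵣ = Allₚ.¬Any⇒All¬ (w′ ∷ inner ρ ++ [ last ρ ]) fresh ∷ uniqueᵣ ρ
      ; withinᵣ = sw ∷ withinᵣ ρ ; lastB = lastB ρ ; lastNotA = lastNotA ρ
      ; firstNotB = ¬bw ; innerNotA = ¬aw′ ∷ innerNotA ρ ; innerNotB = ¬bw′ ∷ innerNotB ρ }
      where
        fresh : w ∉ w′ ∷ inner ρ ++ [ last ρ ]
        fresh (here refl) = loopless w e
        fresh (there w∈) with ∈-++⁻ (inner ρ) w∈
        ... | inj₁ w∈inner    = w∉ w∈inner
        ... | inj₂ (here refl) = ¬bw (lastB ρ)

    shortcutRoute : ∀ {w w′} → ¬ B w → (ρ : Route w′) → w ∈ inner ρ → Route w
    shortcutRoute {w} {w′} ¬bw ρ w∈ with ∈-∃++ w∈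
    ... | pre , post , split = record
      { inner = post ; last = last ρ
      ; linkedᵣ = suffix (Linked E) Linked.tail (linkedᵣ ρ) ; uniqueᵣ = suffix Unique AllPairs.tail (uniqueᵣ ρ)
      ; withinᵣ = suffix (All S) All.tail (withinᵣ ρ) ; lastB = lastB ρ ; lastNotA = lastNotA ρ
      ; firstNotB = ¬bw
      ; innerNotA = All.tail (dropPrefix (All (∁ A)) All.tail pre (subst (All (∁ A)) split (innerNotA ρ)))
      ; innerNotB = All.tail (dropPrefix (All (∁ B)) All.tail pre (subst (All (∁ B)) split (innerNotB ρ))) }
      where
        suffix : (Q : List V → Set) → (∀ {x xs} → Q (x ∷ xs) → Q xs) →
                 Q (w′ ∷ inner ρ ++ [ last ρ ]) → Q (w ∷ post ++ [ last ρ ])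
        suffix Q tail q = dropPrefix Q tail (w′ ∷ pre) (subst Q vertices-split q)
          where
            vertices-split : w′ ∷ inner ρ ++ [ last ρ ] ≡ (w′ ∷ pre) ++ w ∷ post ++ [ last ρ ]
            vertices-split = trans (cong (λ m → w′ ∷ m ++ [ last ρ ]) split)
                                   (cong (w′ ∷_) (++-assoc pre (w ∷ post) [ last ρ ]))

    prependRoute : ∀ {w w′} → S w → E w w′ → ¬ A w′ → ¬ B w′ → ¬ B w → Route w′ → Route w
    prependRoute {w} sw e ¬aw′ ¬bw′ ¬bw ρ with lem {P = w ∈ inner ρ}
    ... | yes w∈ = shortcutRoute ¬bw ρ w∈
    ... | no  w∉ = consRoute sw e ¬aw′ ¬bw′ ¬bw ρ w∉

    -- The route starts at the last A-vertex before the first B-vertex of the walk;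
    -- repeated vertices are short-cut.
    walk⇒route : ∀ {w x} → Reach D S w x → B x → ¬ B w → (∃[ s ] (A s × Route s)) ⊎ Route w
    walk⇒route (here _)              bx ¬bw = ⊥-elim (¬bw bx)
    walk⇒route (step {w = w′} sw e r) bx ¬bw with lem {P = B w′}
    ... | yes bw′ = inj₂ (edgeRoute sw (reach-source r) e ¬bw bw′)
    ... | no ¬bw′ with walk⇒route r bx ¬bw′
    ...   | inj₁ found = inj₁ found
    ...   | inj₂ ρ with lem {P = A w′}
    ...     | yes aw′ = inj₁ (w′ , aw′ , ρ)
    ...     | no ¬aw′ = inj₂ (prependRoute sw e ¬aw′ ¬bw′ ¬bw ρ)

    walk⇒path : ∀ {u x} → A u → Reach D S u x → B x → PathWithin A B S
    walk⇒path au r bx with walk⇒route r bx (disjoint au)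
    ... | inj₁ (s , as , ρ) = route⇒path as ρ
    ... | inj₂ ρ            = route⇒path au ρ

module Rankless (lem : ∀ {ℓ} → ExcludedMiddle ℓ) (D : Digraph) (𝒰 : List (VSet D)) where
  open Digraph D
  open Walks D

  rankless⇒meets : ∀ {S} → ¬ HasRank D 𝒰 S → All (Meets S) 𝒰
  rankless⇒meets {S} ¬rank = meetsAll 𝒰 (¬rank ∘ rank0)
    where
      meetsAll : ∀ Ws → ¬ Any (λ W → Finite D (W ∩ S)) Ws → All (Meets S) Ws
      meetsAll []       _    = []
      meetsAll (W ∷ Ws) ¬fin with lem {P = Meets S W}
      ... | yes meets = meets ∷ meetsAll Ws (¬fin ∘ there)
      ... | no ¬meets = ⊥-elim (¬fin (here ([] , λ v (wv , sv) → ⊥-elim (¬meets (v , sv , wv)))))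

  ranklessComponent : ∀ {S} → ¬ HasRank D 𝒰 S → (X : List V) →
                      ∃[ c ] (Minus D S X c × ¬ HasRank D 𝒰 (Comp D (Minus D S X) c))
  ranklessComponent {S} ¬rank X with lem {P = ∃[ c ] (Minus D S X c × ¬ HasRank D 𝒰 (Comp D (Minus D S X) c))}
  ... | yes found = found
  ... | no  none  = ⊥-elim (¬rank (rankStep X ranked))
    where
      ranked : ∀ v → Minus D S X v → HasRank D 𝒰 (Comp D (Minus D S X) v)
      ranked v v∈ with lem {P = HasRank D 𝒰 (Comp D (Minus D S X) v)}
      ... | yes rank = rank
      ... | no ¬rank = ⊥-elim (none (v , v∈ , ¬rank))

module NecklaceExcludesRank (lem : ∀ {ℓ} → ExcludedMiddle ℓ) (D : Digraph) (𝒰 : List (VSet D))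
                            (N : NecklaceAttached D 𝒰) where
  open Digraph D
  open Walks D
  open NecklaceAttached N

  Piece : ℕ → VSet D
  Piece i v = v ∈ bead i ⊎ v ∈ mid (P i) ⊎ v ∈ mid (Q i)

  piece-unique : ∀ {i j v} → Piece i v → Piece j v → i ≡ j
  piece-unique (inj₁ b)        (inj₁ b′)        = beadsDisjoint _ _ _ b b′
  piece-unique (inj₁ b)        (inj₂ (inj₁ p′)) = ⊥-elim (P-beads _ _ _ p′ b)
  piece-unique (inj₁ b)        (inj₂ (inj₂ q′)) = ⊥-elim (Q-beads _ _ _ q′ b)
  piece-unique (inj₂ (inj₁ p)) (inj₁ b′)        = ⊥-elim (P-beads _ _ _ p b′)
  piece-unique (inj₂ (inj₁ p)) (inj₂ (inj₁ p′)) = PP-disj _ _ _ p p′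
  piece-unique (inj₂ (inj₁ p)) (inj₂ (inj₂ q′)) = ⊥-elim (PQ-disj _ _ _ p q′)
  piece-unique (inj₂ (inj₂ q)) (inj₁ b′)        = ⊥-elim (Q-beads _ _ _ q b′)
  piece-unique (inj₂ (inj₂ q)) (inj₂ (inj₁ p′)) = ⊥-elim (PQ-disj _ _ _ p′ q)
  piece-unique (inj₂ (inj₂ q)) (inj₂ (inj₂ q′)) = QQ-disj _ _ _ q q′

  AvoidsFrom : ℕ → List V → Set
  AvoidsFrom m X = ∀ {i} → m ≤ i → ∀ {v} → v ∈ X → ¬ Piece i v

  eventuallyAvoids : ∀ X → ∃[ m ] AvoidsFrom m X
  eventuallyAvoids []      = 0 , λ _ ()
  eventuallyAvoids (x ∷ X) with eventuallyAvoids X | lem {P = ∃[ i ] Piece i x}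
  ... | m , avoids | yes (i , piece) = suc i ⊔ m , λ
    { le (here refl) piece′ → <⇒≢ (m⊔n≤o⇒m≤o (suc i) m le) (piece-unique piece piece′)
    ; le (there v∈)  → avoids (m⊔n≤o⇒n≤o (suc i) m le) v∈ }
  ... | m , avoids | no ¬piece = m , λ
    { le (here refl) piece′ → ¬piece (_ , piece′)
    ; le (there v∈)  → avoids le v∈ }

  TailIn : ℕ → VSet D → Set
  TailIn k S = ∀ {i} → k ≤ i → Piece i ⊆ S

  hub : ℕ → V
  hub i = start (P i)

  module Tail {k : ℕ} {T : VSet D} (tail⊆T : TailIn k T) where

    beadReach : ∀ {i u w} → k ≤ i → u ∈ bead i → w ∈ bead i → Reach D T u w
    beadReach le u∈ w∈ = reach-mono (tail⊆T le ∘ inj₁) (beadStrong _ _ _ u∈ w∈)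

    P-within : ∀ {i} → k ≤ i → All T (pathVertices (P i))
    P-within le = pathVertices-⊆ (P _) (tail⊆T le (inj₁ (startA (P _))))
      (tail⊆T le ∘ inj₂ ∘ inj₁) (tail⊆T (m≤n⇒m≤1+n le) (inj₁ (endB (P _))))

    Q-within : ∀ {i} → k ≤ i → All T (pathVertices (Q i))
    Q-within le = pathVertices-⊆ (Q _) (tail⊆T (m≤n⇒m≤1+n le) (inj₁ (startA (Q _))))
      (tail⊆T le ∘ inj₂ ∘ inj₂) (tail⊆T le (inj₁ (endB (Q _))))

    hub-link : ∀ {i} → k ≤ i → Comp D T (hub i) (hub (suc i))
    hub-link {i} le =
      reach-trans (path-start⇝end (P i) (P-within le)) (beadReach le′ (endB (P i)) (startA (P (suc i)))) ,
      reach-trans (beadReach le′ (startA (P (suc i))) (startA (Q i)))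
        (reach-trans (path-start⇝end (Q i) (Q-within le)) (beadReach le (endB (Q i)) (startA (P i))))
      where le′ = m≤n⇒m≤1+n le

    hub-comp : ∀ {i} → k ≤′ i → Comp D T (hub k) (hub i)
    hub-comp ≤′-refl        = comp-refl (tail⊆T ≤-refl (inj₁ (startA (P k))))
    hub-comp (≤′-step k≤′i) = comp-trans (hub-comp k≤′i) (hub-link (≤′⇒≤ k≤′i))

    piece-comp : ∀ {i} → k ≤ i → Piece i ⊆ Comp D T (hub i)
    piece-comp le (inj₁ y∈) = beadReach le (startA (P _)) y∈ , beadReach le y∈ (startA (P _))
    piece-comp {i} le (inj₂ (inj₁ y∈)) =
      path-start⇝mid (P i) (Allₚ.++⁻ˡ (hub i ∷ mid (P i)) (P-within le)) y∈ ,
      reach-trans (path-mid⇝end (P i) (All.tail (P-within le)) y∈)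
        (reach-trans (beadReach (m≤n⇒m≤1+n le) (endB (P i)) (startA (P (suc i)))) (proj₂ (hub-link le)))
    piece-comp {i} le (inj₂ (inj₂ y∈)) =
      reach-trans (proj₁ (hub-link le))
        (reach-trans (beadReach (m≤n⇒m≤1+n le) (startA (P (suc i))) (startA (Q i)))
          (path-start⇝mid (Q i) (Allₚ.++⁻ˡ (start (Q i) ∷ mid (Q i)) (Q-within le)) y∈)) ,
      reach-trans (path-mid⇝end (Q i) (All.tail (Q-within le)) y∈) (beadReach le (endB (Q i)) (startA (P i)))

    tail⊆comp : TailIn k (Comp D T (hub k))
    tail⊆comp le piece = comp-trans (hub-comp (≤⇒≤′ le)) (piece-comp le piece)

  rank⇒¬tail : ∀ {S} → HasRank D 𝒰 S → ∀ n → ¬ TailIn n S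
  rank⇒¬tail (rank0 finite) n tail⊆S with lookup-result finite
  ... | xs , cover with eventuallyAvoids xs
  ... | m , avoids with attached (m ⊔ n)
  ... | i , le , meetsAll with proj₁ (All.lookupAny meetsAll finite)
  ... | v , v∈ , wv =
    avoids (m⊔n≤o⇒m≤o m n le) (cover v (wv , tail⊆S (m⊔n≤o⇒n≤o m n le) (inj₁ v∈))) (inj₁ v∈)
  rank⇒¬tail {S} (rankStep X ranked) n tail⊆S with eventuallyAvoids X
  ... | m , avoids = rank⇒¬tail (ranked (hub k) (tail⊆S-X ≤-refl (inj₁ (startA (P k))))) k (Tail.tail⊆comp tail⊆S-X)
    where
      k : ℕ
      k = m ⊔ n
      tail⊆S-X : TailIn k (Minus D S X)
      tail⊆S-X le piece = tail⊆S (m⊔n≤o⇒n≤o m n le) piece , λ v∈X → avoids (m⊔n≤o⇒m≤o m n le) v∈X piece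

  necklace⇒¬rank : ¬ HasRank D 𝒰 U
  necklace⇒¬rank rank = rank⇒¬tail rank 0 (λ _ _ → tt)

module RanklessYieldsNecklace (lem : ∀ {ℓ} → ExcludedMiddle ℓ) (D : Digraph) (𝒰 : List (VSet D)) where
  open Digraph D
  open Walks D
  open PathExtraction lem D
  open Rankless lem D 𝒰

  -- region is a rankless strong component of the previous region minus the previous
  -- used vertices, and used collects all beads chosen so far.
  record Stage : Set₁ where
    field
      region           : VSet D
      bead             : List V
      used             : List V
      anchor           : V
      region-rankless  : ¬ HasRank D 𝒰 region
      region-strong    : StronglyConnected region
      bead⊆region      : InList D bead ⊆ region
      bead⊆used        : InList D bead ⊆ InList D used
      used∩region⊆bead : ∀ {v} → v ∈ used → region v → v ∈ bead
      bead-strong      : StronglyConnected (InList D bead)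
      bead-meets       : All (Meets (InList D bead)) 𝒰
      anchor∈bead      : anchor ∈ bead

  open Stage

  stageOn : (C : VSet D) → ¬ HasRank D 𝒰 C → StronglyConnected C → (old : List V) →
            (∀ {v} → C v → v ∉ old) → ∀ {a b} → C a → C b → Σ[ s ∈ Stage ] b ∈ bead s
  stageOn C ¬rank strong old fresh {a} {b} ca cb = record
    { region = C ; bead = hull ; used = old ++ hull ; anchor = a
    ; region-rankless = ¬rank ; region-strong = strong ; bead⊆region = hull⊆
    ; bead⊆used = ∈-++⁺ʳ old
    ; used∩region⊆bead = λ v∈ cv → [ (λ v∈old → ⊥-elim (fresh cv v∈old)) , (λ v∈hull → v∈hull) ]′ (∈-++⁻ old v∈)
    ; bead-strong = rooted⇒stronglyConnected rooted
    ; bead-meets = All.tail meets ; anchor∈bead = root∈ } , b∈hull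
    where
      -- the singleton {b} is added as a target so that the bead contains b
      open Hull (finiteHull strong ca {Ws = (_≡ b) ∷ 𝒰} ((b , cb , refl) ∷ rankless⇒meets ¬rank))
      b∈hull : b ∈ hull
      b∈hull with All.head meets
      ... | _ , b∈ , refl = b∈

  Interior : ∀ {A B A′ B′} → Path D A B → Path D A′ B′ → VSet D
  Interior p q v = v ∈ mid p ⊎ v ∈ mid q

  record Link (s s′ : Stage) : Set₁ where
    field
      P                    : Path D (InList D (bead s)) (InList D (bead s′))
      Q                    : Path D (InList D (bead s′)) (InList D (bead s))
      region-shrinks       : region s′ ⊆ region s
      region-fresh         : ∀ {v} → region s′ v → v ∉ used s
      used-grows           : InList D (used s) ⊆ InList D (used s′)
      interior⊆region      : Interior P Q ⊆ region s
      interior-leaves      : ∀ {v} → Interior P Q v → ¬ region s′ v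
      interior-avoids-bead : ∀ {v} → Interior P Q v → v ∉ bead s
      P∩Q-empty            : ∀ {v} → v ∈ mid P → v ∈ mid Q → ⊥

  module Extend (s : Stage) where
    M : VSet D
    M = Minus D (region s) (used s)

    component : ∃[ c ] (M c × ¬ HasRank D 𝒰 (Comp D M c))
    component = ranklessComponent (region-rankless s) (used s)

    C : VSet D
    C = Comp D M (proj₁ component)

    C⊆M : C ⊆ M
    C⊆M = reach-target ∘ proj₁

    c∈C : C (proj₁ component)
    c∈C = comp-refl (proj₁ (proj₂ component))

    bead∩C-empty : ∀ {v} → v ∈ bead s → ¬ C v
    bead∩C-empty v∈ cv = proj₂ (C⊆M cv) (bead⊆used s v∈)

    anchor∈region : region s (anchor s)
    anchor∈region = bead⊆region s (anchor∈bead s)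

    P₁-within : PathWithin (InList D (bead s)) C (region s)
    P₁-within = walk⇒path bead∩C-empty (anchor∈bead s)
           (region-strong s _ _ anchor∈region (proj₁ (C⊆M c∈C))) c∈C

    Q₁-within : PathWithin C (InList D (bead s)) (region s)
    Q₁-within = walk⇒path (λ cv v∈ → bead∩C-empty v∈ cv) c∈C
           (region-strong s _ _ (proj₁ (C⊆M c∈C)) anchor∈region) (anchor∈bead s)

    P₁ : Path D (InList D (bead s)) C
    P₁ = proj₁ P₁-within

    Q₁ : Path D C (InList D (bead s))
    Q₁ = proj₁ Q₁-within

    staged : Σ[ s′ ∈ Stage ] start Q₁ ∈ bead s′
    staged = stageOn C (proj₂ (proj₂ component)) comp-stronglyConnected (used s)
               (proj₂ ∘ C⊆M) (endB P₁) (startA Q₁)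

    s′ : Stage
    s′ = proj₁ staged

    interior-avoids-bead : ∀ {v} → Interior P₁ Q₁ v → v ∉ bead s
    interior-avoids-bead (inj₁ v∈) = All.lookup (midNotA P₁) v∈
    interior-avoids-bead (inj₂ v∈) = All.lookup (midNotB Q₁) v∈

    interior⊆region : Interior P₁ Q₁ ⊆ region s
    interior⊆region (inj₁ v∈) = mid⊆ P₁ (proj₂ P₁-within) v∈
    interior⊆region (inj₂ v∈) = mid⊆ Q₁ (proj₂ Q₁-within) v∈

    interior⊆M : Interior P₁ Q₁ ⊆ M
    interior⊆M int = interior⊆region int ,
                     λ v∈used → interior-avoids-bead int (used∩region⊆bead s v∈used (interior⊆region int))

    -- a common interior vertex is reached from C along Q₁ and reaches C along P₁, inside M
    P∩Q⊆C : ∀ {v} → v ∈ mid P₁ → v ∈ mid Q₁ → C v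
    P∩Q⊆C v∈P v∈Q =
      reach-trans (proj₁ (startA Q₁))
        (path-start⇝mid Q₁ (C⊆M (startA Q₁) ∷ All.tabulate (interior⊆M ∘ inj₂)) v∈Q) ,
      reach-trans
        (path-mid⇝end P₁ (Allₚ.++⁺ (All.tabulate (interior⊆M ∘ inj₁)) (C⊆M (endB P₁) ∷ [])) v∈P)
        (proj₂ (endB P₁))

    link : Link s s′
    link = record
      { P = shrinkTarget P₁ (bead⊆region s′) (anchor∈bead s′)
      ; Q = shrinkSource Q₁ (bead⊆region s′) (proj₂ staged)
      ; region-shrinks = proj₁ ∘ C⊆M
      ; region-fresh = proj₂ ∘ C⊆M
      ; used-grows = ∈-++⁺ˡ
      ; interior⊆region = interior⊆region
      ; interior-leaves = λ { (inj₁ v∈) → All.lookup (midNotB P₁) v∈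
                            ; (inj₂ v∈) → All.lookup (midNotA Q₁) v∈ }
      ; interior-avoids-bead = interior-avoids-bead
      ; P∩Q-empty = λ v∈P v∈Q → All.lookup (midNotB P₁) v∈P (P∩Q⊆C v∈P v∈Q) }

  module Sequence (¬rank : ¬ HasRank D 𝒰 U) where
    initial : Stage
    initial = proj₁ (stageOn C (proj₂ (proj₂ component)) comp-stronglyConnected [] (λ _ ()) c∈C c∈C)
      where
        component : ∃[ c ] (Minus D U [] c × ¬ HasRank D 𝒰 (Comp D (Minus D U []) c))
        component = ranklessComponent ¬rank []
        C : VSet D
        C = Comp D (Minus D U []) (proj₁ component)
        c∈C : C (proj₁ component)
        c∈C = comp-refl (proj₁ (proj₂ component))

    stage : ℕ → Stage
    stage zero    = initial
    stage (suc i) = Extend.s′ (stage i)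

    link : ∀ i → Link (stage i) (stage (suc i))
    link i = Extend.link (stage i)

    region-antitone : ∀ {i j} → i ≤′ j → region (stage j) ⊆ region (stage i)
    region-antitone ≤′-refl            r = r
    region-antitone (≤′-step {j} i≤′j) r = region-antitone i≤′j (Link.region-shrinks (link j) r)

    used-monotone : ∀ {i j} → i ≤′ j → InList D (used (stage i)) ⊆ InList D (used (stage j))
    used-monotone ≤′-refl            v∈ = v∈
    used-monotone (≤′-step {j} i≤′j) v∈ = Link.used-grows (link j) (used-monotone i≤′j v∈)

    Interiorᵢ : ℕ → VSet D
    Interiorᵢ i = Interior (Link.P (link i)) (Link.Q (link i))

    region-fresh : ∀ {i j v} → i < j → region (stage j) v → v ∉ used (stage i)
    region-fresh {i} i<j r = Link.region-fresh (link i) (region-antitone (≤⇒≤′ i<j) r)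

    interior-leaves : ∀ {i j v} → i < j → Interiorᵢ i v → ¬ region (stage j) v
    interior-leaves {i} i<j int r = Link.interior-leaves (link i) int (region-antitone (≤⇒≤′ i<j) r)

    beads-disjoint : ∀ {i j v} → v ∈ bead (stage i) → v ∈ bead (stage j) → i ≡ j
    beads-disjoint {v = v} = index-unique {λ i → v ∈ bead (stage i)} λ {i} {j} i<j v∈i v∈j →
      region-fresh i<j (bead⊆region (stage j) v∈j) (bead⊆used (stage i) v∈i)

    interior-unique : ∀ {i j v} → Interiorᵢ i v → Interiorᵢ j v → i ≡ j
    interior-unique {v = v} = index-unique {λ i → Interiorᵢ i v} λ {_} {j} i<j int-i int-j →
      interior-leaves i<j int-i (Link.interior⊆region (link j) int-j)

    interior-avoids-beads : ∀ {i j v} → Interiorᵢ i v → v ∉ bead (stage j)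
    interior-avoids-beads {i} {j} int v∈ with j ≤? i
    ... | yes j≤i = Link.interior-avoids-bead (link i) int
          (used∩region⊆bead (stage i) (used-monotone (≤⇒≤′ j≤i) (bead⊆used (stage j) v∈))
                                      (Link.interior⊆region (link i) int))
    ... | no  j≰i = interior-leaves (≰⇒> j≰i) int (bead⊆region (stage j) v∈)

    P∩Q-empty : ∀ i j v → v ∈ mid (Link.P (link i)) → v ∈ mid (Link.Q (link j)) → ⊥
    P∩Q-empty i j v v∈P v∈Q with interior-unique {i} {j} (inj₁ v∈P) (inj₂ v∈Q)
    ... | refl = Link.P∩Q-empty (link i) v∈P v∈Q

    necklace : NecklaceAttached D 𝒰
    necklace = record
      { bead          = λ i → bead (stage i)
      ; beadsDisjoint = λ _ _ _ → beads-disjoint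
      ; beadStrong    = λ i → bead-strong (stage i)
      ; P             = λ i → Link.P (link i)
      ; Q             = λ i → Link.Q (link i)
      ; PP-disj       = λ _ _ _ v∈ v∈′ → interior-unique (inj₁ v∈) (inj₁ v∈′)
      ; QQ-disj       = λ _ _ _ v∈ v∈′ → interior-unique (inj₂ v∈) (inj₂ v∈′)
      ; PQ-disj       = P∩Q-empty
      ; P-beads       = λ i j _ v∈ → interior-avoids-beads {i} {j} (inj₁ v∈)
      ; Q-beads       = λ i j _ v∈ → interior-avoids-beads {i} {j} (inj₂ v∈)
      ; attached      = λ n → n , ≤-refl , bead-meets (stage n) }

lemma3p5 : (lem : ∀ {ℓ} → ExcludedMiddle ℓ) →
    (D : Digraph) (𝒰 : List (VSet D)) →
    (NecklaceAttached D 𝒰 ⊎ HasRank D 𝒰 U)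
      × ¬ (NecklaceAttached D 𝒰 × HasRank D 𝒰 U)
lemma3p5 lem D 𝒰 = necklace-or-rank , λ (N , rank) → NecklaceExcludesRank.necklace⇒¬rank lem D 𝒰 N rank
  where
    necklace-or-rank : NecklaceAttached D 𝒰 ⊎ HasRank D 𝒰 U
    necklace-or-rank with lem {P = HasRank D 𝒰 U}
    ... | yes rank = inj₂ rank
    ... | no ¬rank = inj₁ (RanklessYieldsNecklace.Sequence.necklace lem D 𝒰 ¬rank)
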